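{- Let $d\ge 5$. For every maximal matching $M$ of $K(Q_d)$ there is a direction $i\in[d]$ such that $|M^i_-|\ge 3$ if $d=5$, and $|M^i_-|\ge 4$ if $d\ge 6$.
   Context: $Q_d$ has vertex set all subsets of $[d]$, two sets adjacent iff they differ in one element; $K(Q_d)$ is the complete graph on $V(Q_d)$. A matching $M$ of $K(Q_d)$ is maximal if it covers at least one end vertex of every edge of $Q_d$. For $i\in[d]$, $M^i_-$ is the set of edges of $M$ joining a vertex not containing $i$ with a vertex containing $i$. -}

module Defs where

open import Data.Nat using (ℕ; _≤_; _≥_; _<_)
open import Data.Bool using (Bool; true; false; not; _≟_)
open import Data.Fin using (Fin)
open import Data.Fin.Subset using (Subset; _∈_; _∉_)
open import Data.Vec using (Vec; lookup; _[_]≔_)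
open import Data.List using (List; length; filter)
open import Data.List.Relation.Unary.Any using (Any)
open import Data.Product using (Σ; ∃; ∃-syntax; _×_; _,_; proj₁; proj₂)
open import Data.Sum using (_⊎_)
open import Relation.Binary.PropositionalEquality using (_≡_; _≢_)
open import Relation.Nullary using (¬_; Dec; yes; no)
open import Relation.Nullary.Decidable using (_×-dec_; _⊎-dec_)

-- Vertices of Q_d: subsets of [d] = Fin d, as characteristic vectors.
Vertex : ℕ → Set
Vertex d = Subset d

Edge : ℕ → Set
Edge d = Vertex d × Vertex d

QAdj : {d : ℕ} → Vertex d → Vertex d → Set
QAdj {d} u v = ∃[ i ] v ≡ (u [ i ]≔ not (lookup u i))

_incident_ : {d : ℕ} → Vertex d → Edge d → Set
x incident e = (x ≡ proj₁ e) ⊎ (x ≡ proj₂ e)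

Covers : {d : ℕ} → List (Edge d) → Vertex d → Set
Covers M x = Any (x incident_) M

-- A matching of K(Q_d), given as a list of edges: every listed edge joins
-- two distinct vertices, and edges at distinct list positions share no
-- endpoint (so in particular no edge is listed twice).
IsMatching : {d : ℕ} → List (Edge d) → Set
IsMatching {d} M =
  (∀ (k : Fin (length M)) → proj₁ (Data.List.lookup M k) ≢ proj₂ (Data.List.lookup M k)) ×
  (∀ (k l : Fin (length M)) (x : Vertex d) →
     x incident Data.List.lookup M k → x incident Data.List.lookup M l → k ≡ l)

IsMaximalMatching : {d : ℕ} → List (Edge d) → Set
IsMaximalMatching {d} M =
  IsMatching M × (∀ (u v : Vertex d) → QAdj u v → Covers M u ⊎ Covers M v)

Crosses : {d : ℕ} → Fin d → Edge d → Set
Crosses i (u , v) = (lookup u i ≡ false × lookup v i ≡ true) ⊎ (lookup u i ≡ true × lookup v i ≡ false)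

crosses? : {d : ℕ} (i : Fin d) (e : Edge d) → Dec (Crosses i e)
crosses? i (u , v) = ((lookup u i ≟ false) ×-dec (lookup v i ≟ true)) ⊎-dec ((lookup u i ≟ true) ×-dec (lookup v i ≟ false))

M[_]₋ : {d : ℕ} → List (Edge d) → Fin d → List (Edge d)
M[ M ]₋ i = filter (crosses? i) M

card₋ : {d : ℕ} → List (Edge d) → Fin d → ℕ
card₋ M i = length (M[ M ]₋ i)

-- The vertices covered by a maximal matching M form a vertex cover of Q_d.  An edge of K(Q_d)
-- joining adjacent vertices covers one vertex of each parity, and any other edge crosses at least
-- two directions; so each edge covers at most as many vertices of a given parity as it crosses
-- directions, and each parity class of the cover has at most Σᵢ |M^i_-| vertices (only the
-- looplessness of M is used, not its disjointness).  Splitting Q_{d+1} into two copies of Q_d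
-- propagates certified constraints on the (even, odd) profile of vertex covers, showing that a
-- cover of Q_5 (resp. Q_6) has at least 11 (resp. 19) vertices of one parity; for d ≥ 7 any cover
-- has at least 2^(d-1) > 6d vertices.  Pigeonhole over the d directions concludes.

module Submission where

open import Data.Bool using (Bool; true; false; not; _∨_; if_then_else_; T)
import Data.Bool as Bool
open import Data.Bool.ListAction using (all)
open import Data.Bool.Properties using (T-∨; T-≡; not-involutive)
open import Data.Empty using (⊥-elim)
open import Data.Fin using (Fin; zero; suc)
open import Data.Fin.Properties using (any?)
open import Data.List using (List; []; _∷_; upTo)
import Data.List as List
open import Data.List.Membership.Propositional.Properties using (∈-upTo⁺)
import Data.List.Relation.Unary.All as All
open import Data.List.Relation.Unary.All.Properties using (all⁺)
import Data.List.Relation.Unary.Any as Any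
open import Data.Nat using (ℕ; zero; suc; _+_; _*_; _^_; _≤_; _<_; _≥_; z≤n; s≤s; _≤ᵇ_; _≤?_)
open import Data.Nat.Properties
open import Data.Nat.Tactic.RingSolver using (solve-∀)
open import Data.Product using (∃-syntax; _×_; _,_; proj₁; proj₂; map₂)
open import Data.Sum using (_⊎_; inj₁; inj₂)
import Data.Sum as Sum
open import Data.Unit using (tt)
open import Data.Vec using ([]; _∷_; lookup; _[_]≔_)
open import Data.Vec.Properties using (≡-dec)
open import Defs
open import Function using (_∘_; Equivalence)
open import Relation.Binary.Definitions using (DecidableEquality)
open import Relation.Binary.PropositionalEquality
open import Relation.Nullary using (Dec; yes; no; does; contradiction)
open import Relation.Nullary.Decidable using (_⊎-dec_; dec-true)

open import Algebra.Properties.CommutativeMonoid.Sum +-0-commutativeMonoid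
  using (sum-syntax; sum-cong-≗; ∑-distrib-+)
open import Algebra.Properties.CommutativeSemigroup +-commutativeSemigroup using (interchange)

-- Counting vertices by parity

private
  variable
    d : ℕ

_≟ᵥ_ : DecidableEquality (Vertex d)
_≟ᵥ_ = ≡-dec Bool._≟_

-- count p d χ is the number of vertices of Q_d of parity p (false: even) satisfying χ;
-- ofParity p u is that number for χ = {u}.
count : Bool → (d : ℕ) → (Vertex d → Bool) → ℕ
count p (suc d) χ = count p d (χ ∘ (false ∷_)) + count (not p) d (χ ∘ (true ∷_))
count false zero χ = if χ [] then 1 else 0
count true  zero χ = 0

ofParity : Bool → Vertex d → ℕ
ofParity p (false ∷ u) = ofParity p u
ofParity p (true  ∷ u) = ofParity (not p) u
ofParity false [] = 1
ofParity true  [] = 0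

ofParity≤1 : ∀ p (u : Vertex d) → ofParity p u ≤ 1
ofParity≤1 p (false ∷ u) = ofParity≤1 p u
ofParity≤1 p (true  ∷ u) = ofParity≤1 (not p) u
ofParity≤1 false [] = ≤-refl
ofParity≤1 true  [] = z≤n

ofParity+ofParity-not : ∀ p (u : Vertex d) → ofParity p u + ofParity (not p) u ≡ 1
ofParity+ofParity-not p (false ∷ u) = ofParity+ofParity-not p u
ofParity+ofParity-not p (true  ∷ u) = ofParity+ofParity-not (not p) u
ofParity+ofParity-not false [] = refl
ofParity+ofParity-not true  [] = refl

count-mono : ∀ p d {f g : Vertex d → Bool} → (∀ x → T (f x) → T (g x)) → count p d f ≤ count p d g
count-mono p (suc d) f⇒g =
  +-mono-≤ (count-mono p d (f⇒g ∘ (false ∷_))) (count-mono (not p) d (f⇒g ∘ (true ∷_)))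
count-mono false zero {f} {g} f⇒g with f [] | g [] | f⇒g []
... | true  | true  | _    = ≤-refl
... | true  | false | f⇒g₀ = ⊥-elim (f⇒g₀ tt)
... | false | _     | _    = z≤n
count-mono true zero _ = z≤n

count-∨ : ∀ p d (f g : Vertex d → Bool) → count p d (λ x → f x ∨ g x) ≤ count p d f + count p d g
count-∨ p (suc d) f g =
  ≤-trans (+-mono-≤ (count-∨ p d _ _) (count-∨ (not p) d _ _))
          (≤-reflexive (interchange (count p d f₀) (count p d g₀) (count (not p) d f₁) (count (not p) d g₁)))
  where
  f₀ f₁ g₀ g₁ : Vertex d → Bool
  f₀ = f ∘ (false ∷_)
  f₁ = f ∘ (true ∷_)
  g₀ = g ∘ (false ∷_)
  g₁ = g ∘ (true ∷_)
count-∨ false zero f g with f [] | g []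
... | true  | _     = s≤s z≤n
... | false | true  = s≤s z≤n
... | false | false = z≤n
count-∨ true zero f g = z≤n

count-empty : ∀ p d → count p d (λ _ → false) ≡ 0
count-empty p (suc d) = cong₂ _+_ (count-empty p d) (count-empty (not p) d)
count-empty false zero = refl
count-empty true  zero = refl

count-singleton : ∀ p d (u : Vertex d) → count p d (λ x → does (x ≟ᵥ u)) ≡ ofParity p u
count-singleton p (suc d) (false ∷ u) =
  trans (cong₂ _+_ (count-singleton p d u) (count-empty (not p) d)) (+-identityʳ _)
count-singleton p (suc d) (true ∷ u) =
  cong₂ _+_ (count-empty p d) (count-singleton (not p) d u)
count-singleton false zero [] = refl
count-singleton true  zero [] = refl

count≤count-full : ∀ p (χ : Vertex d → Bool) → count p d χ ≤ count p d (λ _ → true)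
count≤count-full {d} p χ = count-mono p d (λ _ _ → tt)

count-full : ∀ d → count false d (λ _ → true) + count true d (λ _ → true) ≡ 2 ^ d
count-full zero = refl
count-full (suc d) = cong₂ _+_ (count-full d)
  (trans (+-comm (count true d _) _) (trans (count-full d) (sym (+-identityʳ _))))

-- Crossings of a matching

crossing : Fin d → Edge d → ℕ
crossing i e = if does (crosses? i e) then 1 else 0

distance : Edge d → ℕ
distance {d} e = ∑[ i < d ] crossing i e

distance-pos : ∀ (u v : Vertex d) → u ≢ v → 1 ≤ distance (u , v)
distance-pos (false ∷ u) (false ∷ v) u≢v = distance-pos u v (u≢v ∘ cong (false ∷_))
distance-pos (true  ∷ u) (true  ∷ v) u≢v = distance-pos u v (u≢v ∘ cong (true ∷_))
distance-pos (false ∷ u) (true  ∷ v) _ = s≤s z≤n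
distance-pos (true  ∷ u) (false ∷ v) _ = s≤s z≤n
distance-pos [] [] u≢v = ⊥-elim (u≢v refl)

ofParity-opposite≤distance : ∀ p (u v : Vertex d) → ofParity p u + ofParity (not p) v ≤ suc (distance (u , v))
ofParity-opposite≤distance p u v with u ≟ᵥ v
... | yes refl = ≤-trans (≤-reflexive (ofParity+ofParity-not p u)) (s≤s z≤n)
... | no u≢v   = +-mono-≤ (ofParity≤1 p u) (≤-trans (ofParity≤1 (not p) v) (distance-pos u v u≢v))

ofParity≤distance : ∀ p (u v : Vertex d) → u ≢ v → ofParity p u + ofParity p v ≤ distance (u , v)
ofParity≤distance p (false ∷ u) (false ∷ v) u≢v = ofParity≤distance p u v (u≢v ∘ cong (false ∷_))
ofParity≤distance p (true  ∷ u) (true  ∷ v) u≢v = ofParity≤distance (not p) u v (u≢v ∘ cong (true ∷_))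
ofParity≤distance p (false ∷ u) (true  ∷ v) _ = ofParity-opposite≤distance p u v
ofParity≤distance p (true  ∷ u) (false ∷ v) _ =
  subst (λ q → ofParity (not p) u + ofParity q v ≤ _) (not-involutive p) (ofParity-opposite≤distance (not p) u v)
ofParity≤distance p [] [] u≢v = ⊥-elim (u≢v refl)

crossings : List (Edge d) → ℕ
crossings {d} M = ∑[ i < d ] card₋ M i

card₋-∷ : ∀ (e : Edge d) M i → card₋ (e ∷ M) i ≡ crossing i e + card₋ M i
card₋-∷ e M i with does (crosses? i e)
... | true  = refl
... | false = refl

crossings-∷ : ∀ (e : Edge d) M → crossings (e ∷ M) ≡ distance e + crossings M
crossings-∷ e M = trans (sum-cong-≗ (card₋-∷ e M)) (∑-distrib-+ (λ i → crossing i e) (card₋ M))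

covers? : (M : List (Edge d)) (x : Vertex d) → Dec (Covers M x)
covers? M x = Any.any? (λ e → (x ≟ᵥ proj₁ e) ⊎-dec (x ≟ᵥ proj₂ e)) M

covered : List (Edge d) → Vertex d → Bool
covered M x = does (covers? M x)

Loopless : List (Edge d) → Set
Loopless M = ∀ k → proj₁ (List.lookup M k) ≢ proj₂ (List.lookup M k)

count-covered≤crossings : ∀ p (M : List (Edge d)) → Loopless M → count p d (covered M) ≤ crossings M
count-covered≤crossings {d} p [] _ = ≤-trans (≤-reflexive (count-empty p d)) z≤n
count-covered≤crossings {d} p ((u , v) ∷ M) loopless = begin
  count p d (covered ((u , v) ∷ M))
    ≤⟨ count-∨ p d _ (covered M) ⟩
  count p d (λ x → does (x ≟ᵥ u) ∨ does (x ≟ᵥ v)) + count p d (covered M)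
    ≤⟨ +-monoˡ-≤ _ (count-∨ p d _ _) ⟩
  (count p d (λ x → does (x ≟ᵥ u)) + count p d (λ x → does (x ≟ᵥ v))) + count p d (covered M)
    ≡⟨ cong₂ (λ m n → m + n + _) (count-singleton p d u) (count-singleton p d v) ⟩
  (ofParity p u + ofParity p v) + count p d (covered M)
    ≤⟨ +-mono-≤ (ofParity≤distance p u v (loopless zero)) (count-covered≤crossings p M (loopless ∘ suc)) ⟩
  distance (u , v) + crossings M
    ≡⟨ crossings-∷ (u , v) M ⟨
  crossings ((u , v) ∷ M) ∎
  where open ≤-Reasoning

-- Vertex covers

IsVertexCover : (Vertex d → Bool) → Set
IsVertexCover {d} χ = ∀ (u : Vertex d) i → T (χ u ∨ χ (u [ i ]≔ not (lookup u i)))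

covered-isVertexCover : ∀ (M : List (Edge d)) → IsMaximalMatching M → IsVertexCover (covered M)
covered-isVertexCover M (_ , maximal) u i =
  Equivalence.from T-∨ (Sum.map covers⇒T covers⇒T (maximal u _ (i , refl)))
  where
  covers⇒T : ∀ {x} → Covers M x → T (covered M x)
  covers⇒T c = Equivalence.from T-≡ (dec-true (covers? M _) c)

half-isVertexCover : ∀ b (χ : Vertex (suc d) → Bool) → IsVertexCover χ → IsVertexCover (χ ∘ (b ∷_))
half-isVertexCover b χ cover u i = cover (b ∷ u) (suc i)

halves-count : ∀ p (χ : Vertex (suc d) → Bool) → IsVertexCover χ →
  count p d (λ _ → true) ≤ count p d (χ ∘ (false ∷_)) + count p d (χ ∘ (true ∷_))
halves-count {d} p χ cover = ≤-trans (count-mono p d (λ x _ → cover (false ∷ x) zero)) (count-∨ p d _ _)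

∀≤ : ℕ → (ℕ → Bool) → Bool
∀≤ n p = all p (upTo (suc n))

∀≤-elim : ∀ n p → T (∀≤ n p) → ∀ {a} → a ≤ n → T (p a)
∀≤-elim n p holds a≤n = All.lookup (all⁺ p _ holds) (∈-upTo⁺ (s≤s a≤n))

infixr 5 _⇒ᵇ_
_⇒ᵇ_ : Bool → Bool → Bool
true  ⇒ᵇ b = b
false ⇒ᵇ _ = true

⇒ᵇ-elim : ∀ {a b} → T (a ⇒ᵇ b) → T a → T b
⇒ᵇ-elim {true} a⇒b _ = a⇒b

∀≤²-elim : ∀ {e o a b} (P : ℕ → ℕ → Bool) → T (∀≤ e λ a → ∀≤ o (P a)) → a ≤ e → b ≤ o → T (P a b)
∀≤²-elim {e} {o} {a} P holds a≤e = ∀≤-elim o (P a) (∀≤-elim e _ holds a≤e)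

-- Constraints on the profile (#even vertices, #odd vertices) of a vertex cover.
Constraint : Set
Constraint = ℕ → ℕ → Bool

record Bounds (d : ℕ) (t : Constraint) : Set where
  constructor bounds
  field profile : ∀ χ → IsVertexCover {d} χ → T (t (count false d χ) (count true d χ))
open Bounds

-- A cover of Q_{d+1} restricts to covers with profiles (a₀ , b₀) and (a₁ , b₁) of the two halves
-- {x ∌ i₀} and {x ∋ i₀} of Q_{d+1}, each a copy of Q_d; the halves jointly cover Q_d, which has
-- e even and o odd vertices, and the whole cover has profile (a₀ + b₁ , b₀ + a₁).
glue : Constraint → ℕ → ℕ → ℕ → ℕ → ℕ → ℕ → Bool
glue t′ e o a₀ b₀ a₁ b₁ = (e ≤ᵇ a₀ + a₁) ⇒ᵇ (o ≤ᵇ b₀ + b₁) ⇒ᵇ t′ (a₀ + b₁) (b₀ + a₁)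

extends : Constraint → Constraint → ℕ → ℕ → Bool
extends t t′ e o =
  ∀≤ e λ a₀ → ∀≤ o λ b₀ → t a₀ b₀ ⇒ᵇ
  ∀≤ e λ a₁ → ∀≤ o λ b₁ → t a₁ b₁ ⇒ᵇ glue t′ e o a₀ b₀ a₁ b₁

bounds-suc : ∀ {d t t′} → Bounds d t →
  T (extends t t′ (count false d (λ _ → true)) (count true d (λ _ → true))) → Bounds (suc d) t′
bounds-suc {d} {t} {t′} bound check = bounds extend
  where
  extend : ∀ χ → IsVertexCover χ → T (t′ (count false (suc d) χ) (count true (suc d) χ))
  extend χ cover =
    ⇒ᵇ-elim (⇒ᵇ-elim (⇒ᵇ-elim at-χ₁ (profile bound χ₁ (half-isVertexCover true χ cover))) (≤⇒≤ᵇ (halves-count false χ cover)))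
      (≤⇒≤ᵇ (halves-count true χ cover))
    where
    χ₀ χ₁ : Vertex d → Bool
    χ₀ = χ ∘ (false ∷_)
    χ₁ = χ ∘ (true ∷_)
    e o a₀ b₀ a₁ b₁ : ℕ
    e = count false d (λ _ → true)
    o = count true d (λ _ → true)
    a₀ = count false d χ₀
    b₀ = count true d χ₀
    a₁ = count false d χ₁
    b₁ = count true d χ₁
    at-χ₀ : T (t a₀ b₀ ⇒ᵇ ∀≤ e λ a₁ → ∀≤ o λ b₁ → t a₁ b₁ ⇒ᵇ glue t′ e o a₀ b₀ a₁ b₁)
    at-χ₀ = ∀≤²-elim _ check (count≤count-full false χ₀) (count≤count-full true χ₀)
    at-χ₁ : T (t a₁ b₁ ⇒ᵇ glue t′ e o a₀ b₀ a₁ b₁)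
    at-χ₁ = ∀≤²-elim _ (⇒ᵇ-elim at-χ₀ (profile bound χ₀ (half-isVertexCover false χ cover))) (count≤count-full false χ₁) (count≤count-full true χ₁)

entails : Constraint → Constraint → ℕ → ℕ → Bool
entails t t′ e o = ∀≤ e λ a → ∀≤ o λ b → t a b ⇒ᵇ t′ a b

bounds-weaken : ∀ {d t t′} → Bounds d t →
  T (entails t t′ (count false d (λ _ → true)) (count true d (λ _ → true))) → Bounds d t′
bounds-weaken {d} bound check = bounds λ χ cover →
  ⇒ᵇ-elim (∀≤²-elim _ check (count≤count-full false χ) (count≤count-full true χ)) (profile bound χ cover)

-- minOdd ms a b: a cover with a even vertices has at least ms[a] odd ones (no constraint past the end of ms).
minOdd : List ℕ → Constraint
minOdd []       a       b = true
minOdd (m ∷ ms) zero    b = m ≤ᵇ b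
minOdd (m ∷ ms) (suc a) b = minOdd ms a b

atLeast : ℕ → Constraint
atLeast n a b = (n ≤ᵇ a) ∨ (n ≤ᵇ b)

bounds-Q₁ : Bounds 1 (minOdd (1 ∷ 0 ∷ []))
bounds-Q₁ = bounds-suc {t = λ _ _ → true} (bounds λ _ _ → tt) tt

bounds-Q₂ : Bounds 2 (minOdd (2 ∷ 2 ∷ 0 ∷ []))
bounds-Q₂ = bounds-suc bounds-Q₁ tt

bounds-Q₃ : Bounds 3 (minOdd (4 ∷ 4 ∷ 4 ∷ 3 ∷ 0 ∷ []))
bounds-Q₃ = bounds-suc bounds-Q₂ tt

bounds-Q₄ : Bounds 4 (minOdd (8 ∷ 8 ∷ 8 ∷ 8 ∷ 7 ∷ 7 ∷ 6 ∷ 4 ∷ 0 ∷ []))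
bounds-Q₄ = bounds-suc bounds-Q₃ tt

bounds-Q₅ : Bounds 5 (minOdd (16 ∷ 16 ∷ 16 ∷ 16 ∷ 16 ∷ 15 ∷ 15 ∷ 15 ∷ 14 ∷ 14 ∷ 13 ∷ 11 ∷ 11 ∷ 10 ∷ 8 ∷ 5 ∷ 0 ∷ []))
bounds-Q₅ = bounds-suc bounds-Q₄ tt

cover-Q₅ : Bounds 5 (atLeast 11)
cover-Q₅ = bounds-weaken bounds-Q₅ tt

cover-Q₆ : Bounds 6 (atLeast 19)
cover-Q₆ = bounds-suc bounds-Q₅ tt

atLeast-bound⇒≤crossings : ∀ {M : List (Edge d)} n → IsMaximalMatching M → Bounds d (atLeast n) → n ≤ crossings M
atLeast-bound⇒≤crossings {M = M} n mm@((loopless , _) , _) bound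
  with Equivalence.to T-∨ (profile bound (covered M) (covered-isVertexCover M mm))
... | inj₁ even = ≤-trans (≤ᵇ⇒≤ n _ even) (count-covered≤crossings false M loopless)
... | inj₂ odd  = ≤-trans (≤ᵇ⇒≤ n _ odd)  (count-covered≤crossings true M loopless)

cover-size : ∀ (χ : Vertex (suc d) → Bool) → IsVertexCover χ →
  2 ^ d ≤ count false (suc d) χ + count true (suc d) χ
cover-size {d} χ cover = begin
  2 ^ d
    ≡⟨ count-full d ⟨
  count false d (λ _ → true) + count true d (λ _ → true)
    ≤⟨ +-mono-≤ (halves-count false χ cover) (halves-count true χ cover) ⟩
  (count false d χ₀ + count false d χ₁) + (count true d χ₀ + count true d χ₁)
    ≡⟨ regroup (count false d χ₀) (count false d χ₁) (count true d χ₀) (count true d χ₁) ⟩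
  count false (suc d) χ + count true (suc d) χ ∎
  where
  open ≤-Reasoning
  χ₀ χ₁ : Vertex d → Bool
  χ₀ = χ ∘ (false ∷_)
  χ₁ = χ ∘ (true ∷_)
  regroup : ∀ a₀ a₁ b₀ b₁ → (a₀ + a₁) + (b₀ + b₁) ≡ (a₀ + b₁) + (b₀ + a₁)
  regroup = solve-∀

half-cube≤crossings : ∀ {M : List (Edge (suc d))} → IsMaximalMatching M → 2 ^ d ≤ 2 * crossings M
half-cube≤crossings {d} {M} mm@((loopless , _) , _) = begin
  2 ^ d
    ≤⟨ cover-size (covered M) (covered-isVertexCover M mm) ⟩
  count false (suc d) (covered M) + count true (suc d) (covered M)
    ≤⟨ +-mono-≤ (count-covered≤crossings false M loopless) (count-covered≤crossings true M loopless) ⟩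
  crossings M + crossings M
    ≡⟨ cong (crossings M +_) (+-identityʳ (crossings M)) ⟨
  2 * crossings M ∎
  where open ≤-Reasoning

3d<2^[d-2] : ∀ k → (7 + k) * 3 < 2 ^ (5 + k)
3d<2^[d-2] zero    = ≤ᵇ⇒≤ 22 32 tt
3d<2^[d-2] (suc k) = begin-strict
  3 + (7 + k) * 3   <⟨ +-monoʳ-< 3 (3d<2^[d-2] k) ⟩
  3 + 2 ^ (5 + k)   ≤⟨ +-monoˡ-≤ (2 ^ (5 + k)) (≤-trans (m≤m+n 3 ((6 + k) * 3)) (<⇒≤ (3d<2^[d-2] k))) ⟩
  2 ^ (5 + k) + 2 ^ (5 + k)       ≡⟨ cong (2 ^ (5 + k) +_) (+-identityʳ (2 ^ (5 + k))) ⟨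
  2 ^ (6 + k) ∎
  where open ≤-Reasoning

-- Pigeonhole

sum≤ : ∀ {n c} (f : Fin n → ℕ) → (∀ i → f i ≤ c) → ∑[ i < n ] f i ≤ n * c
sum≤ {zero}  f f≤c = z≤n
sum≤ {suc n} f f≤c = +-mono-≤ (f≤c zero) (sum≤ (f ∘ suc) (f≤c ∘ suc))

direction-with-crossings : ∀ c (M : List (Edge d)) → d * c < crossings M → ∃[ i ] suc c ≤ card₋ M i
direction-with-crossings c M many with any? (λ i → suc c ≤? card₋ M i)
... | yes found = found
... | no none   = contradiction (sum≤ (card₋ M) (λ i → ≮⇒≥ (none ∘ (i ,_)))) (<⇒≱ many)

lemma21 : (d : ℕ) → d ≥ 5 → (M : List (Edge d)) → IsMaximalMatching M →
    ∃[ i ] ((d ≡ 5 × 3 ≤ card₋ M i) ⊎ (d ≥ 6 × 4 ≤ card₋ M i))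
lemma21 5 _ M mm =
  map₂ (λ three → inj₁ (refl , three)) (direction-with-crossings 2 M (atLeast-bound⇒≤crossings 11 mm cover-Q₅))
lemma21 6 _ M mm =
  map₂ (λ four → inj₂ (≤-refl , four)) (direction-with-crossings 3 M (atLeast-bound⇒≤crossings 19 mm cover-Q₆))
lemma21 (suc (suc (suc (suc (suc (suc (suc k))))))) _ M mm =
  map₂ (λ four → inj₂ (m≤m+n 6 (suc k) , four))
    (direction-with-crossings 3 M
      (*-cancelˡ-< 2 _ _ (<-≤-trans (*-monoʳ-< 2 (3d<2^[d-2] k)) (half-cube≤crossings mm))))
lemma21 1 (s≤s ()) _ _
lemma21 2 (s≤s (s≤s ())) _ _
lemma21 3 (s≤s (s≤s (s≤s ()))) _ _
lemma21 4 (s≤s (s≤s (s≤s (s≤s ())))) _ _
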